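{- The (infinitary) cut rule — from $\vdash\Gamma,\Phi$ and, for every $\varphi\in\Phi$, a premise $\vdash\Delta_\varphi,\overline{\varphi}$, infer $\vdash\Gamma,\Delta$ where $\Delta=\biguplus_{\varphi\in\Phi}\Delta_\varphi$ — is admissible in $\mathtt{IK}_\omega$. In particular, ordinary cut is admissible in $\mathtt{IK}_\omega$.
   Context: $\mathtt{IK}_\omega$ is a one-sided sequent calculus whose sequents consist of (possibly countably infinite) multisets of formulas built from literals $P,\overline{P}$ with $\otimes$ (multiplicative conjunction), $⅋$ (multiplicative disjunction, "par"), $\forall$ and $\exists$, with no truth predicate; $t_1,t_2,\ldots$ enumerates all terms and $\biguplus$ denotes infinitary multiset union. Rules: initial sequents $\vdash\Gamma,P,\overline{P}$; from $\vdash\Gamma,A,B$ infer $\vdash\Gamma,A⅋B$; from $\vdash\Gamma,A$ and $\vdash\Delta,B$ infer $\vdash\Gamma,\Delta,A\otimes B$; from $\vdash\Gamma_i,A(t_i/x)$ for every $i\in I$ infer $\vdash\biguplus_{i\in I}\Gamma_i,\forall xA$; from $\vdash\Gamma,A(t_1/x),A(t_2/x),\ldots$ infer $\vdash\Gamma,\exists xA$. Derivations are well-founded, possibly infinitely branching trees with ordinal heights. -}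

module Defs where

open import Data.Nat using (ℕ; suc)
open import Data.Fin using (Fin; zero; suc)
open import Data.Vec using (Vec; []; _∷_)
open import Data.Sum using (_⊎_; inj₁; inj₂)
open import Data.Product using (Σ; _,_)
open import Data.Unit using (⊤)
open import Function.Bundles using (_↣_; _↔_; Inverse)
open import Relation.Binary.PropositionalEquality using (_≡_)

-- A countable first-order signature (countably many function symbols,
-- so that the closed terms can be enumerated t₁, t₂, …).
record Signature : Set₁ where
  field
    Fun           : Set
    arity         : Fun → ℕ
    Pred          : Set
    parity        : Pred → ℕ
    Fun-countable : Fun ↣ ℕ

module IK (σ : Signature) where
  open Signature σ

  data Term (n : ℕ) : Set where
    var : Fin n → Term n
    fn  : (f : Fun) → Vec (Term n) (arity f) → Term n

  CTerm : Set
  CTerm = Term 0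

  data Form (n : ℕ) : Set where
    pos neg   : (p : Pred) → Vec (Term n) (parity p) → Form n
    _⊗_ _⅋_   : Form n → Form n → Form n
    all ex    : Form (suc n) → Form n

  dual : ∀ {n} → Form n → Form n
  dual (pos p ts) = neg p ts
  dual (neg p ts) = pos p ts
  dual (A ⊗ B)    = dual A ⅋ dual B
  dual (A ⅋ B)    = dual A ⊗ dual B
  dual (all A)    = ex (dual A)
  dual (ex A)     = all (dual A)

  mutual
    renT : ∀ {n m} → (Fin n → Fin m) → Term n → Term m
    renT ρ (var i)   = var (ρ i)
    renT ρ (fn f ts) = fn f (renTs ρ ts)

    renTs : ∀ {n m k} → (Fin n → Fin m) → Vec (Term n) k → Vec (Term m) k
    renTs ρ []       = []
    renTs ρ (t ∷ ts) = renT ρ t ∷ renTs ρ ts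

  mutual
    subT : ∀ {n m} → (Fin n → Term m) → Term n → Term m
    subT s (var i)   = s i
    subT s (fn f ts) = fn f (subTs s ts)

    subTs : ∀ {n m k} → (Fin n → Term m) → Vec (Term n) k → Vec (Term m) k
    subTs s []       = []
    subTs s (t ∷ ts) = subT s t ∷ subTs s ts

  lift : ∀ {n m} → (Fin n → Term m) → Fin (suc n) → Term (suc m)
  lift s zero    = var zero
  lift s (suc i) = renT suc (s i)

  subF : ∀ {n m} → (Fin n → Term m) → Form n → Form m
  subF s (pos p ts) = pos p (subTs s ts)
  subF s (neg p ts) = neg p (subTs s ts)
  subF s (A ⊗ B)    = subF s A ⊗ subF s B
  subF s (A ⅋ B)    = subF s A ⅋ subF s B
  subF s (all A)    = all (subF (lift s) A)
  subF s (ex A)     = ex (subF (lift s) A)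

  _[_] : Form 1 → CTerm → Form 0
  A [ t ] = subF (λ _ → t) A

  -- (possibly infinite) multisets of closed formulas, as indexed families;
  -- a Bag is used for contexts, a Seq is a countable multiset (a sequent).
  record Bag : Set₁ where
    constructor bag
    field
      I   : Set
      lab : I → Form 0

  record Seq : Set₁ where
    field
      Idx       : Set
      fm        : Idx → Form 0
      countable : Idx ↣ ℕ

  _⊕_ : Bag → Bag → Bag
  bag I f ⊕ bag J g = bag (I ⊎ J) λ { (inj₁ i) → f i ; (inj₂ j) → g j }
  infixl 5 _⊕_

  ⟨_⟩ : Form 0 → Bag
  ⟨ A ⟩ = bag ⊤ (λ _ → A)

  ⨄ : (J : Set) → (J → Bag) → Bag
  ⨄ J Γ = bag (Σ J (λ j → Bag.I (Γ j))) (λ { (j , i) → Bag.lab (Γ j) i })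

  _≅_ : Seq → Bag → Set
  S ≅ B = Σ (Seq.Idx S ↔ Bag.I B)
            (λ e → ∀ x → Seq.fm S x ≡ Bag.lab B (Inverse.to e x))
  infix 4 _≅_

  data ⊢_ : Seq → Set₁ where
    init : ∀ {S} (Γ : Bag) (p : Pred) (ts : Vec CTerm (parity p)) →
           S ≅ Γ ⊕ ⟨ pos p ts ⟩ ⊕ ⟨ neg p ts ⟩ → ⊢ S
    par  : ∀ {S} (S′ : Seq) (Γ : Bag) (A B : Form 0) →
           ⊢ S′ → S′ ≅ Γ ⊕ ⟨ A ⟩ ⊕ ⟨ B ⟩ →
           S ≅ Γ ⊕ ⟨ A ⅋ B ⟩ → ⊢ S
    tens : ∀ {S} (S₁ S₂ : Seq) (Γ Δ : Bag) (A B : Form 0) →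
           ⊢ S₁ → S₁ ≅ Γ ⊕ ⟨ A ⟩ →
           ⊢ S₂ → S₂ ≅ Δ ⊕ ⟨ B ⟩ →
           S ≅ Γ ⊕ Δ ⊕ ⟨ A ⊗ B ⟩ → ⊢ S
    all-rule : ∀ {S} (S′ : CTerm → Seq) (Γ : CTerm → Bag) (A : Form 1) →
           (∀ t → ⊢ S′ t) → (∀ t → S′ t ≅ Γ t ⊕ ⟨ A [ t ] ⟩) →
           S ≅ ⨄ CTerm Γ ⊕ ⟨ all A ⟩ → ⊢ S
    ex-rule : ∀ {S} (S′ : Seq) (Γ : Bag) (A : Form 1) →
           ⊢ S′ → S′ ≅ Γ ⊕ ⨄ CTerm (λ t → ⟨ A [ t ] ⟩) →
           S ≅ Γ ⊕ ⟨ ex A ⟩ → ⊢ S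

{-# OPTIONS --safe #-}
module Submission where

open import Defs
open import Level using (0ℓ) renaming (suc to lsuc)
open import Algebra.Bundles using (CommutativeMonoid)
open import Data.Empty.Polymorphic using (⊥; ⊥-elim)
open import Data.Fin using (Fin)
open import Data.Nat using (ℕ; zero; suc; _+_; _*_; _≤_; _<_; z≤n; s≤s)
open import Data.Nat.Induction using (<-rec)
open import Data.Nat.Properties
  using ( *-cancelˡ-≡; even≢odd; suc-injective; *-suc; *-monoʳ-≤; +-mono-≤; n<1+n
        ; m≤m+n; m≤n+m; ≤-refl; ≤-trans; ≤-reflexive; module ≤-Reasoning)
open import Data.Product using (Σ; _,_; proj₁; proj₂; _×_)
open import Data.Product.Algebra using (Σ-assoc-alt)
open import Data.Product.Function.Dependent.Propositional using (Σ-↔)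
open import Data.Sum using (_⊎_; inj₁; inj₂)
open import Data.Sum.Algebra using (⊎-cong; ⊎-comm; ⊎-assoc; ⊎-identityʳ)
open import Data.Sum.Function.Propositional using (_⊎-↣_)
open import Data.Sum.Properties using (inj₁-injective; inj₂-injective)
open import Data.Unit using (⊤; tt)
open import Data.Vec using (Vec; []; _∷_)
open import Function using (_∘_; const)
open import Function.Bundles using (_↣_; _↔_; Inverse; Injection; mk↣; mk↔ₛ′)
open import Function.Definitions using (Injective)
open import Function.Properties.Injection using (↣-trans)
open import Function.Properties.Inverse using (↔-refl; ↔-sym; ↔-trans; ↔⇒↣)
open import Relation.Binary.PropositionalEquality
  using (_≡_; refl; sym; trans; cong; cong₂; subst)
open import Relation.Nullary using (contradiction)
import Algebra.Solver.CommutativeMonoid as CommutativeMonoidSolver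
import Algebra.Structures.Biased as Biased

-- All cuts of the infinitary rule are eliminated at once, by one induction on
-- the derivation of ⊢ Γ,Φ. The induction is generic: annotate each formula
-- occurrence of the end sequent with what should replace it; if every rule can
-- be rebuilt at its principal formula from its premises, transformed under all
-- fitting annotations of the active formulas, then the transformed end sequent
-- is derivable. Annotations "keep / add a multiset / unfold" give weakening at a
-- literal and inversion of ⅋ and ∃. Annotations "keep / cut φ against a
-- derivation of Δ_φ, φ̄" push the cuts up to the principal occurrences of the
-- cut formulas. At an axiom, the cut is a weakening of the derivation of Δ_φ, φ̄.
-- A cut on ⊗ or ∀ becomes cuts on the immediate subformulas after inverting the
-- dual ⅋ or ∃ premise, while a cut on ⅋ or ∃ is traded for the cut on its
-- positive dual with the two derivations swapped. Both reductions lower the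
-- weight 2·size + polarity, so well-founded induction on the weight closes the
-- argument.

Countable : Set → Set
Countable A = A ↣ ℕ

interleave : ℕ ⊎ ℕ → ℕ
interleave (inj₁ m) = 2 * m
interleave (inj₂ n) = suc (2 * n)

interleave-injective : Injective _≡_ _≡_ interleave
interleave-injective {inj₁ m} {inj₁ n} eq = cong inj₁ (*-cancelˡ-≡ m n 2 eq)
interleave-injective {inj₁ m} {inj₂ n} eq = contradiction eq (even≢odd m n)
interleave-injective {inj₂ m} {inj₁ n} eq = contradiction (sym eq) (even≢odd n m)
interleave-injective {inj₂ m} {inj₂ n} eq = cong inj₂ (*-cancelˡ-≡ m n 2 (suc-injective eq))

pair : ℕ → ℕ → ℕ
pair zero    n = interleave (inj₁ n)
pair (suc m) n = interleave (inj₂ (pair m n))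

pair-injective : ∀ m n m′ n′ → pair m n ≡ pair m′ n′ → m ≡ m′ × n ≡ n′
pair-injective zero    n zero     n′ eq = refl , inj₁-injective (interleave-injective eq)
pair-injective zero    n (suc m′) n′ eq
  with () ← interleave-injective {inj₁ n} {inj₂ (pair m′ n′)} eq
pair-injective (suc m) n zero     n′ eq
  with () ← interleave-injective {inj₂ (pair m n)} {inj₁ n′} eq
pair-injective (suc m) n (suc m′) n′ eq
  with refl , refl ← pair-injective m n m′ n′ (inj₂-injective (interleave-injective eq)) =
  refl , refl

⊤-countable : Countable ⊤
⊤-countable = mk↣ {to = const 0} λ _ → refl

⊎-countable : ∀ {A B} → Countable A → Countable B → Countable (A ⊎ B)
⊎-countable f g = ↣-trans (f ⊎-↣ g) (mk↣ interleave-injective)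

⊎-countableˡ : ∀ {A B} → Countable (A ⊎ B) → Countable A
⊎-countableˡ = ↣-trans (mk↣ inj₁-injective)

⊎-countableʳ : ∀ {A B} → Countable (A ⊎ B) → Countable B
⊎-countableʳ = ↣-trans (mk↣ inj₂-injective)

snoc-countable : ∀ {A} → Countable A → Countable (A ⊎ ⊤)
snoc-countable c = ⊎-countable c ⊤-countable

Σ-countable : ∀ {A} {B : A → Set} → Countable A → (∀ a → Countable (B a)) → Countable (Σ A B)
Σ-countable {A} {B} f g = mk↣ {to = encode} injective
  where
  encode : Σ A B → ℕ
  encode (a , b) = pair (Injection.to f a) (Injection.to (g a) b)

  injective : Injective _≡_ _≡_ encode
  injective {a , b} {a′ , b′} eq with pair-injective _ _ _ _ eq
  ... | fa≡fa′ , gb≡gb′ with refl ← Injection.injective f fa≡fa′ =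
    cong (a ,_) (Injection.injective (g a) gb≡gb′)

↔-countable : ∀ {A B} → A ↔ B → Countable A → Countable B
↔-countable e = ↣-trans (↔⇒↣ (↔-sym e))

Σ-countable-fibre : ∀ {A} {B : A → Set} → Countable (Σ A B) → ∀ a → Countable (B a)
Σ-countable-fibre c a = ↣-trans (mk↣ {to = a ,_} λ { refl → refl }) c

module CutElimination (σ : Signature) where
  open Signature σ
  open IK σ

  private
    variable
      Γ Δ Ψ W X Y : Bag
      S : Seq
      φ A B : Form 0
      p : Pred
      ts : Vec CTerm _

  mutual
    encode : CTerm → ℕ
    encode (var ())
    encode (fn f ts) = pair (Injection.to Fun-countable f) (encodes ts)

    encodes : ∀ {k} → Vec CTerm k → ℕ
    encodes []       = 0
    encodes (t ∷ ts) = suc (pair (encode t) (encodes ts))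

  mutual
    encode-injective : ∀ t u → encode t ≡ encode u → t ≡ u
    encode-injective (var ()) _
    encode-injective (fn f ts) (fn g us) eq with pair-injective _ _ _ _ eq
    ... | f≡g , ts≡us with refl ← Injection.injective Fun-countable f≡g =
      cong (fn f) (encodes-injective ts us ts≡us)

    encodes-injective : ∀ {k} (ts us : Vec CTerm k) → encodes ts ≡ encodes us → ts ≡ us
    encodes-injective []       []       _  = refl
    encodes-injective (t ∷ ts) (u ∷ us) eq with pair-injective _ _ _ _ (suc-injective eq)
    ... | t≡u , ts≡us = cong₂ _∷_ (encode-injective t u t≡u) (encodes-injective ts us ts≡us)

  CTerm-countable : Countable CTerm
  CTerm-countable = mk↣ (encode-injective _ _)

  -- Multisets of formulas

  record _≋_ (X Y : Bag) : Set where
    constructor mk≋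
    field
      index : Bag.I X ↔ Bag.I Y
      label : ∀ i → Bag.lab X i ≡ Bag.lab Y (Inverse.to index i)
  infix 4 _≋_

  ≋-refl : X ≋ X
  ≋-refl = mk≋ ↔-refl λ _ → refl

  ≋-sym : X ≋ Y → Y ≋ X
  ≋-sym {Y = Y} (mk≋ e l) = mk≋ (↔-sym e) λ j →
    sym (trans (l (Inverse.from e j)) (cong (Bag.lab Y) (Inverse.strictlyInverseˡ e j)))

  ≋-trans : ∀ {X Y Z} → X ≋ Y → Y ≋ Z → X ≋ Z
  ≋-trans (mk≋ e l) (mk≋ f m) = mk≋ (↔-trans e f) λ i → trans (l i) (m (Inverse.to e i))

  ≡⇒≋ : X ≡ Y → X ≋ Y
  ≡⇒≋ refl = ≋-refl

  ∅ : Bag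
  ∅ = bag ⊥ ⊥-elim

  ⊕-cong : ∀ {X X′ Y Y′} → X ≋ X′ → Y ≋ Y′ → X ⊕ Y ≋ X′ ⊕ Y′
  ⊕-cong (mk≋ e l) (mk≋ f m) = mk≋ (⊎-cong e f) λ { (inj₁ i) → l i ; (inj₂ j) → m j }

  ⊕-assoc : ∀ X Y Z → X ⊕ Y ⊕ Z ≋ X ⊕ (Y ⊕ Z)
  ⊕-assoc _ _ _ = mk≋ (⊎-assoc 0ℓ _ _ _)
    λ { (inj₁ (inj₁ _)) → refl ; (inj₁ (inj₂ _)) → refl ; (inj₂ _) → refl }

  ⊕-comm : ∀ X Y → X ⊕ Y ≋ Y ⊕ X
  ⊕-comm _ _ = mk≋ (⊎-comm _ _) λ { (inj₁ _) → refl ; (inj₂ _) → refl }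

  ⊕-identityʳ : ∀ X → X ⊕ ∅ ≋ X
  ⊕-identityʳ _ = mk≋ (⊎-identityʳ 0ℓ _) λ { (inj₁ _) → refl }

  ⊕-commutativeMonoid : CommutativeMonoid (lsuc 0ℓ) 0ℓ
  ⊕-commutativeMonoid = record
    { Carrier = Bag
    ; _≈_ = _≋_
    ; _∙_ = _⊕_
    ; ε = ∅
    ; isCommutativeMonoid = Biased.isCommutativeMonoidʳ record
      { isSemigroup = record
        { isMagma = record
          { isEquivalence = record { refl = ≋-refl ; sym = ≋-sym ; trans = ≋-trans }
          ; ∙-cong = ⊕-cong
          }
        ; assoc = ⊕-assoc
        }
      ; identityʳ = ⊕-identityʳ
      ; comm = ⊕-comm
      }
    }

  open CommutativeMonoidSolver ⊕-commutativeMonoid using (solve; _⊜_) renaming (_⊕_ to _⊞_)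

  ⨄-cong : ∀ {J} {F G : J → Bag} → (∀ j → F j ≋ G j) → ⨄ J F ≋ ⨄ J G
  ⨄-cong h = mk≋ (Σ-↔ ↔-refl λ {j} → _≋_.index (h j)) λ (j , i) → _≋_.label (h j) i

  ⨄-reindex : ∀ {J K} (e : J ↔ K) (F : K → Bag) → ⨄ J (F ∘ Inverse.to e) ≋ ⨄ K F
  ⨄-reindex e _ = mk≋ (Σ-↔ e ↔-refl) λ _ → refl

  ⨄-⊤ : (F : ⊤ → Bag) → ⨄ ⊤ F ≋ F tt
  ⨄-⊤ _ = mk≋ (mk↔ₛ′ proj₂ (tt ,_) (λ _ → refl) (λ _ → refl)) λ _ → refl

  ⨄-⊎ : ∀ {J K} (F : J ⊎ K → Bag) → ⨄ (J ⊎ K) F ≋ ⨄ J (F ∘ inj₁) ⊕ ⨄ K (F ∘ inj₂)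
  ⨄-⊎ _ = mk≋
    (mk↔ₛ′ (λ { (inj₁ j , i) → inj₁ (j , i) ; (inj₂ k , i) → inj₂ (k , i) })
           (λ { (inj₁ (j , i)) → inj₁ j , i ; (inj₂ (k , i)) → inj₂ k , i })
           (λ { (inj₁ _) → refl ; (inj₂ _) → refl })
           (λ { (inj₁ _ , _) → refl ; (inj₂ _ , _) → refl }))
    λ { (inj₁ _ , _) → refl ; (inj₂ _ , _) → refl }

  ⨄-Σ : ∀ {J} {K : J → Set} (F : Σ J K → Bag) → ⨄ (Σ J K) F ≋ ⨄ J (λ j → ⨄ (K j) (λ k → F (j , k)))
  ⨄-Σ _ = mk≋ Σ-assoc-alt λ _ → refl

  ⨄-singletons : ∀ X → ⨄ (Bag.I X) (⟨_⟩ ∘ Bag.lab X) ≋ X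
  ⨄-singletons _ = mk≋ (mk↔ₛ′ proj₁ (_, tt) (λ _ → refl) (λ _ → refl)) λ _ → refl

  ≅-resp-≋ : S ≅ X → X ≋ Y → S ≅ Y
  ≅-resp-≋ (e , l) (mk≋ f m) = ↔-trans e f , λ i → trans (l i) (m (Inverse.to e i))

  presentations-≋ : S ≅ X → S ≅ Y → X ≋ Y
  presentations-≋ (e , l) (e′ , l′) = ≋-trans (≋-sym (mk≋ e l)) (mk≋ e′ l′)

  sequent : (X : Bag) → Countable (Bag.I X) → Seq
  sequent X c = record { Idx = Bag.I X ; fm = Bag.lab X ; countable = c }

  sequent-≅ : ∀ X c → sequent X c ≅ X
  sequent-≅ _ _ = ↔-refl , λ _ → refl

  -- Each rule fixes its conclusion only up to multiset equality.
  ⊢-resp : ∀ {T} → ⊢ S → (∀ {X} → S ≅ X → T ≅ X) → ⊢ T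
  ⊢-resp (init Γ p ts e) h = init Γ p ts (h {Γ ⊕ ⟨ pos p ts ⟩ ⊕ ⟨ neg p ts ⟩} e)
  ⊢-resp (par S′ Γ A B d e′ e) h = par S′ Γ A B d e′ (h {Γ ⊕ ⟨ A ⅋ B ⟩} e)
  ⊢-resp (tens S₁ S₂ Γ Δ A B d₁ e₁ d₂ e₂ e) h =
    tens S₁ S₂ Γ Δ A B d₁ e₁ d₂ e₂ (h {Γ ⊕ Δ ⊕ ⟨ A ⊗ B ⟩} e)
  ⊢-resp (all-rule S′ Γ A ds e′ e) h = all-rule S′ Γ A ds e′ (h {⨄ CTerm Γ ⊕ ⟨ all A ⟩} e)
  ⊢-resp (ex-rule S′ Γ A d e′ e) h = ex-rule S′ Γ A d e′ (h {Γ ⊕ ⟨ ex A ⟩} e)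

  -- Every countable sequent presenting the bag must be derivable, so the
  -- countability of a side multiset can be read off the requested conclusion.
  Derivable : Bag → Set₁
  Derivable X = ∀ T → T ≅ X → ⊢ T

  derivable : ⊢ S → S ≅ X → Derivable X
  derivable {S} {X} d e T e′ =
    ⊢-resp d λ {Y} e″ → ≅-resp-≋ {T} {X} e′ (presentations-≋ {S} {X} {Y} e e″)

  derivation : Derivable X → (c : Countable (Bag.I X)) → ⊢ sequent X c
  derivation D c = D _ (sequent-≅ _ c)

  Derivable-resp : X ≋ Y → Derivable X → Derivable Y
  Derivable-resp {Y = Y} k D T e = D T (≅-resp-≋ {T} {Y} e (≋-sym k))

  Derivable-resp-≡ : A ≡ B → Derivable (Γ ⊕ ⟨ A ⟩) → Derivable (Γ ⊕ ⟨ B ⟩)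
  Derivable-resp-≡ refl D = D

  axiom : ∀ Γ p ts → Derivable (Γ ⊕ ⟨ pos p ts ⟩ ⊕ ⟨ neg p ts ⟩)
  axiom Γ p ts _ = init Γ p ts

  ⅋-intro : Derivable (Γ ⊕ ⟨ A ⟩ ⊕ ⟨ B ⟩) → Derivable (Γ ⊕ ⟨ A ⅋ B ⟩)
  ⅋-intro {Γ} {A} {B} D T e = par (sequent P c) Γ A B (derivation D c) (sequent-≅ P c) e
    where
    P = Γ ⊕ ⟨ A ⟩ ⊕ ⟨ B ⟩
    c = snoc-countable (snoc-countable (⊎-countableˡ (↔-countable (proj₁ e) (Seq.countable T))))

  ⊗-intro : Derivable (Γ ⊕ ⟨ A ⟩) → Derivable (Δ ⊕ ⟨ B ⟩) → Derivable (Γ ⊕ Δ ⊕ ⟨ A ⊗ B ⟩)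
  ⊗-intro {Γ} {A} {Δ} {B} D₁ D₂ T e =
    tens (sequent P₁ c₁) (sequent P₂ c₂) Γ Δ A B
         (derivation D₁ c₁) (sequent-≅ P₁ c₁) (derivation D₂ c₂) (sequent-≅ P₂ c₂) e
    where
    P₁ = Γ ⊕ ⟨ A ⟩
    P₂ = Δ ⊕ ⟨ B ⟩
    cΓΔ = ⊎-countableˡ (↔-countable (proj₁ e) (Seq.countable T))
    c₁ = snoc-countable (⊎-countableˡ cΓΔ)
    c₂ = snoc-countable (⊎-countableʳ cΓΔ)

  ∀-intro : ∀ {Γ : CTerm → Bag} {A} → (∀ t → Derivable (Γ t ⊕ ⟨ A [ t ] ⟩)) →
            Derivable (⨄ CTerm Γ ⊕ ⟨ all A ⟩)
  ∀-intro {Γ} {A} D T e =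
    all-rule (λ t → sequent (P t) (c t)) Γ A
             (λ t → derivation (D t) (c t)) (λ t → sequent-≅ (P t) (c t)) e
    where
    P = λ t → Γ t ⊕ ⟨ A [ t ] ⟩
    cΓ = Σ-countable-fibre (⊎-countableˡ (↔-countable (proj₁ e) (Seq.countable T)))
    c = λ t → snoc-countable (cΓ t)

  ∃-intro : ∀ {A} → Derivable (Γ ⊕ ⨄ CTerm (λ t → ⟨ A [ t ] ⟩)) → Derivable (Γ ⊕ ⟨ ex A ⟩)
  ∃-intro {Γ} {A} D T e = ex-rule (sequent P c) Γ A (derivation D c) (sequent-≅ P c) e
    where
    P = Γ ⊕ ⨄ CTerm (λ t → ⟨ A [ t ] ⟩)
    c = ⊎-countable (⊎-countableˡ (↔-countable (proj₁ e) (Seq.countable T)))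
                    (Σ-countable CTerm-countable λ _ → ⊤-countable)

  dual-involutive : ∀ {n} (A : Form n) → dual (dual A) ≡ A
  dual-involutive (pos _ _) = refl
  dual-involutive (neg _ _) = refl
  dual-involutive (A ⊗ B)   = cong₂ _⊗_ (dual-involutive A) (dual-involutive B)
  dual-involutive (A ⅋ B)   = cong₂ _⅋_ (dual-involutive A) (dual-involutive B)
  dual-involutive (all A)   = cong all (dual-involutive A)
  dual-involutive (ex A)    = cong ex (dual-involutive A)

  dual-subF : ∀ {n m} (s : Fin n → Term m) (A : Form n) → dual (subF s A) ≡ subF s (dual A)
  dual-subF s (pos _ _) = refl
  dual-subF s (neg _ _) = refl
  dual-subF s (A ⊗ B)   = cong₂ _⅋_ (dual-subF s A) (dual-subF s B)
  dual-subF s (A ⅋ B)   = cong₂ _⊗_ (dual-subF s A) (dual-subF s B)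
  dual-subF s (all A)   = cong ex (dual-subF (lift s) A)
  dual-subF s (ex A)    = cong all (dual-subF (lift s) A)

  dual-dual-[] : ∀ (A : Form 1) t → dual (dual A [ t ]) ≡ A [ t ]
  dual-dual-[] A t = trans (dual-subF _ (dual A)) (cong (_[ t ]) (dual-involutive A))

  size : ∀ {n} → Form n → ℕ
  size (pos _ _) = 0
  size (neg _ _) = 0
  size (A ⊗ B)   = suc (size A + size B)
  size (A ⅋ B)   = suc (size A + size B)
  size (all A)   = suc (size A)
  size (ex A)    = suc (size A)

  size-dual : ∀ {n} (A : Form n) → size (dual A) ≡ size A
  size-dual (pos _ _) = refl
  size-dual (neg _ _) = refl
  size-dual (A ⊗ B)   = cong₂ (λ a b → suc (a + b)) (size-dual A) (size-dual B)
  size-dual (A ⅋ B)   = cong₂ (λ a b → suc (a + b)) (size-dual A) (size-dual B)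
  size-dual (all A)   = cong suc (size-dual A)
  size-dual (ex A)    = cong suc (size-dual A)

  size-subF : ∀ {n m} (s : Fin n → Term m) (A : Form n) → size (subF s A) ≡ size A
  size-subF s (pos _ _) = refl
  size-subF s (neg _ _) = refl
  size-subF s (A ⊗ B)   = cong₂ (λ a b → suc (a + b)) (size-subF s A) (size-subF s B)
  size-subF s (A ⅋ B)   = cong₂ (λ a b → suc (a + b)) (size-subF s A) (size-subF s B)
  size-subF s (all A)   = cong suc (size-subF (lift s) A)
  size-subF s (ex A)    = cong suc (size-subF (lift s) A)

  polarity : Form 0 → ℕ
  polarity (pos _ _) = 0
  polarity (neg _ _) = 1
  polarity (_ ⊗ _)   = 0
  polarity (_ ⅋ _)   = 1
  polarity (all _)   = 0
  polarity (ex _)    = 1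

  polarity≤1 : ∀ φ → polarity φ ≤ 1
  polarity≤1 (pos _ _) = z≤n
  polarity≤1 (neg _ _) = ≤-refl
  polarity≤1 (_ ⊗ _)   = z≤n
  polarity≤1 (_ ⅋ _)   = ≤-refl
  polarity≤1 (all _)   = z≤n
  polarity≤1 (ex _)    = ≤-refl

  -- A cut on a negative formula is traded for the cut on its positive dual,
  -- so negative formulas weigh one more than their duals.
  weight : Form 0 → ℕ
  weight φ = polarity φ + 2 * size φ

  weight< : ∀ φ {n} → size φ ≤ n → weight φ < 2 * suc n
  weight< φ {n} φ≤n = begin-strict
    polarity φ + 2 * size φ  ≤⟨ +-mono-≤ (polarity≤1 φ) (*-monoʳ-≤ 2 φ≤n) ⟩
    1 + 2 * n                <⟨ n<1+n _ ⟩
    2 + 2 * n                ≡⟨ sym (*-suc 2 n) ⟩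
    2 * suc n                ∎
    where open ≤-Reasoning

  weight-⊗ˡ : ∀ A B → weight (dual A) < weight (A ⊗ B)
  weight-⊗ˡ A B = weight< (dual A) (≤-trans (≤-reflexive (size-dual A)) (m≤m+n _ _))

  weight-⊗ʳ : ∀ A B → weight (dual B) < weight (A ⊗ B)
  weight-⊗ʳ A B = weight< (dual B) (≤-trans (≤-reflexive (size-dual B)) (m≤n+m _ _))

  weight-∀ : ∀ A t → weight (dual A [ t ]) < weight (all A)
  weight-∀ A t = weight< (dual A [ t ]) (≤-reflexive (trans (size-subF _ (dual A)) (size-dual A)))

  weight-⅋ : ∀ A B → weight (dual A ⊗ dual B) < weight (A ⅋ B)
  weight-⅋ A B rewrite size-dual A | size-dual B = n<1+n _

  weight-∃ : ∀ A → weight (all (dual A)) < weight (ex A)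
  weight-∃ A rewrite size-dual A = n<1+n _

  -- Replacing formula occurrences along a derivation

  module Replacement {Ann : Set₁} (Fits : Form 0 → Ann → Set₁) (replace : Form 0 → Ann → Bag) where

    _⟦_⟧ : (X : Bag) → (Bag.I X → Ann) → Bag
    X ⟦ ρ ⟧ = ⨄ (Bag.I X) (λ i → replace (Bag.lab X i) (ρ i))

    Fitting : (X : Bag) → (Bag.I X → Ann) → Set₁
    Fitting X ρ = ∀ i → Fits (Bag.lab X i) (ρ i)

    Replaceable : Bag → Set₁
    Replaceable X = ∀ ρ → Fitting X ρ → Derivable (X ⟦ ρ ⟧)

    _▸_ : {J : Set} → (J → Ann) → Ann → J ⊎ ⊤ → Ann
    (ρ ▸ a) (inj₁ i) = ρ i
    (ρ ▸ a) (inj₂ _) = a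

    fits-▸ : ∀ {ρ a} → Fitting X ρ → Fits φ a → Fitting (X ⊕ ⟨ φ ⟩) (ρ ▸ a)
    fits-▸ f fa (inj₁ i) = f i
    fits-▸ f fa (inj₂ _) = fa

    ⟦⟧-⊕ : ∀ X Y ρ → (X ⊕ Y) ⟦ ρ ⟧ ≋ X ⟦ ρ ∘ inj₁ ⟧ ⊕ Y ⟦ ρ ∘ inj₂ ⟧
    ⟦⟧-⊕ _ _ _ = ⨄-⊎ _

    ⟦⟧-snoc : ∀ X φ ρ → (X ⊕ ⟨ φ ⟩) ⟦ ρ ⟧ ≋ X ⟦ ρ ∘ inj₁ ⟧ ⊕ replace φ (ρ (inj₂ tt))
    ⟦⟧-snoc X φ ρ = ≋-trans (⟦⟧-⊕ X ⟨ φ ⟩ ρ) (⊕-cong ≋-refl (⨄-⊤ _))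

    ⟦⟧-snoc² : ∀ X φ ψ ρ →
               (X ⊕ ⟨ φ ⟩ ⊕ ⟨ ψ ⟩) ⟦ ρ ⟧ ≋
               X ⟦ ρ ∘ inj₁ ∘ inj₁ ⟧ ⊕ replace φ (ρ (inj₁ (inj₂ tt))) ⊕ replace ψ (ρ (inj₂ tt))
    ⟦⟧-snoc² X φ ψ ρ = ≋-trans (⟦⟧-snoc (X ⊕ ⟨ φ ⟩) ψ ρ) (⊕-cong (⟦⟧-snoc X φ (ρ ∘ inj₁)) ≋-refl)

    ⟦⟧-⨄ : ∀ J (F : J → Bag) ρ → (⨄ J F) ⟦ ρ ⟧ ≋ ⨄ J (λ j → F j ⟦ ρ ∘ (j ,_) ⟧)
    ⟦⟧-⨄ _ _ _ = ⨄-Σ _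

    Replaceable-resp : X ≋ Y → Replaceable X → Replaceable Y
    Replaceable-resp {X} {Y} k R ρ f = Derivable-resp reindexed (R (ρ ∘ to) fits)
      where
      open _≋_ k
      to = Inverse.to index
      fits : ∀ i → Fits (Bag.lab X i) (ρ (to i))
      fits i = subst (λ ψ → Fits ψ (ρ (to i))) (sym (label i)) (f (to i))
      reindexed : X ⟦ ρ ∘ to ⟧ ≋ Y ⟦ ρ ⟧
      reindexed = ≋-trans
        (⨄-cong λ i → ≡⇒≋ (cong (λ ψ → replace ψ (ρ (to i))) (label i)))
        (⨄-reindex index (λ j → replace (Bag.lab Y j) (ρ j)))

    record Compatible : Set₁ where
      field
        at-init : ∀ Γ p ts {a b} → Fits (pos p ts) a → Fits (neg p ts) b →
                  Derivable (Γ ⊕ replace (pos p ts) a ⊕ replace (neg p ts) b)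
        at-⅋    : ∀ Γ A B {r} → Fits (A ⅋ B) r →
                  (∀ {a b} → Fits A a → Fits B b → Derivable (Γ ⊕ replace A a ⊕ replace B b)) →
                  Derivable (Γ ⊕ replace (A ⅋ B) r)
        at-⊗    : ∀ Γ Δ A B {r} → Fits (A ⊗ B) r →
                  (∀ {a} → Fits A a → Derivable (Γ ⊕ replace A a)) →
                  (∀ {b} → Fits B b → Derivable (Δ ⊕ replace B b)) →
                  Derivable (Γ ⊕ Δ ⊕ replace (A ⊗ B) r)
        at-∀    : ∀ (Γ : CTerm → Bag) A {r} → Fits (all A) r →
                  (∀ t {a} → Fits (A [ t ]) a → Derivable (Γ t ⊕ replace (A [ t ]) a)) →
                  Derivable (⨄ CTerm Γ ⊕ replace (all A) r)
        at-∃    : ∀ Γ A {r} → Fits (ex A) r →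
                  (∀ {a : CTerm → Ann} → (∀ t → Fits (A [ t ]) (a t)) →
                     Derivable (Γ ⊕ ⨄ CTerm (λ t → replace (A [ t ]) (a t)))) →
                  Derivable (Γ ⊕ replace (ex A) r)

    module _ (compatible : Compatible) where
      open Compatible compatible

      init-replaceable : ∀ Γ p ts → Replaceable (Γ ⊕ ⟨ pos p ts ⟩ ⊕ ⟨ neg p ts ⟩)
      init-replaceable Γ p ts ρ f =
        Derivable-resp (≋-sym (⟦⟧-snoc² Γ _ _ ρ))
          (at-init _ p ts (f (inj₁ (inj₂ tt))) (f (inj₂ tt)))

      ⅋-replaceable : Replaceable (Γ ⊕ ⟨ A ⟩ ⊕ ⟨ B ⟩) → Replaceable (Γ ⊕ ⟨ A ⅋ B ⟩)
      ⅋-replaceable {Γ} {A} {B} R ρ f =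
        Derivable-resp (≋-sym (⟦⟧-snoc Γ (A ⅋ B) ρ)) (at-⅋ _ A B (f (inj₂ tt)) λ fa fb →
          Derivable-resp (⟦⟧-snoc² Γ A B _) (R _ (fits-▸ (fits-▸ (f ∘ inj₁) fa) fb)))

      ⊗-replaceable : Replaceable (Γ ⊕ ⟨ A ⟩) → Replaceable (Δ ⊕ ⟨ B ⟩) →
                      Replaceable (Γ ⊕ Δ ⊕ ⟨ A ⊗ B ⟩)
      ⊗-replaceable {Γ} {A} {Δ} {B} R₁ R₂ ρ f =
        Derivable-resp (≋-sym (≋-trans (⟦⟧-snoc (Γ ⊕ Δ) (A ⊗ B) ρ) (⊕-cong (⟦⟧-⊕ Γ Δ _) ≋-refl)))
          (at-⊗ _ _ A B (f (inj₂ tt))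
            (λ fa → Derivable-resp (⟦⟧-snoc Γ A _) (R₁ _ (fits-▸ (f ∘ inj₁ ∘ inj₁) fa)))
            (λ fb → Derivable-resp (⟦⟧-snoc Δ B _) (R₂ _ (fits-▸ (f ∘ inj₁ ∘ inj₂) fb))))

      ∀-replaceable : ∀ {Γ : CTerm → Bag} {A} → (∀ t → Replaceable (Γ t ⊕ ⟨ A [ t ] ⟩)) →
                      Replaceable (⨄ CTerm Γ ⊕ ⟨ all A ⟩)
      ∀-replaceable {Γ} {A} R ρ f =
        Derivable-resp (≋-sym (≋-trans (⟦⟧-snoc (⨄ CTerm Γ) (all A) ρ)
                                       (⊕-cong (⟦⟧-⨄ CTerm Γ _) ≋-refl)))
          (at-∀ _ A (f (inj₂ tt)) λ t fa →
            Derivable-resp (⟦⟧-snoc (Γ t) (A [ t ]) _) (R t _ (fits-▸ (f ∘ inj₁ ∘ (t ,_)) fa)))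

      ∃-replaceable : ∀ {A} → Replaceable (Γ ⊕ ⨄ CTerm (λ t → ⟨ A [ t ] ⟩)) →
                      Replaceable (Γ ⊕ ⟨ ex A ⟩)
      ∃-replaceable {Γ} {A} R ρ f =
        Derivable-resp (≋-sym (⟦⟧-snoc Γ (ex A) ρ)) (at-∃ _ A (f (inj₂ tt)) λ {a} fa →
          Derivable-resp (instances a)
            (R (extend a) λ { (inj₁ i) → f (inj₁ i) ; (inj₂ (t , _)) → fa t }))
        where
        Instances = ⨄ CTerm (λ t → ⟨ A [ t ] ⟩)
        extend : (CTerm → Ann) → Bag.I (Γ ⊕ Instances) → Ann
        extend a (inj₁ i)       = ρ (inj₁ i)
        extend a (inj₂ (t , _)) = a t
        instances : ∀ a → (Γ ⊕ Instances) ⟦ extend a ⟧ ≋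
                          Γ ⟦ ρ ∘ inj₁ ⟧ ⊕ ⨄ CTerm (λ t → replace (A [ t ]) (a t))
        instances a = ≋-trans (⟦⟧-⊕ Γ Instances _)
          (⊕-cong ≋-refl (≋-trans (⟦⟧-⨄ CTerm _ _) (⨄-cong λ t → ⨄-⊤ _)))

      replacement : ⊢ S → S ≅ X → Replaceable X
      replacement {S} (init Γ p ts e) e′ =
        Replaceable-resp (presentations-≋ {S} e e′) (init-replaceable Γ p ts)
      replacement {S} (par _ Γ A B d e₀ e) e′ =
        Replaceable-resp (presentations-≋ {S} e e′) (⅋-replaceable (replacement d e₀))
      replacement {S} (tens _ _ Γ Δ A B d₁ e₁ d₂ e₂ e) e′ =
        Replaceable-resp (presentations-≋ {S} e e′)
          (⊗-replaceable (replacement d₁ e₁) (replacement d₂ e₂))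
      replacement {S} (all-rule _ Γ A ds e₀ e) e′ =
        Replaceable-resp (presentations-≋ {S} e e′) (∀-replaceable λ t → replacement (ds t) (e₀ t))
      replacement {S} (ex-rule _ Γ A d e₀ e) e′ =
        Replaceable-resp (presentations-≋ {S} e e′) (∃-replaceable (replacement d e₀))

  data StructAnn : Set₁ where
    keep   : StructAnn
    add    : Bag → StructAnn
    invert : StructAnn

  data FitsStruct : Form 0 → StructAnn → Set₁ where
    keep     : FitsStruct φ keep
    add-pos  : FitsStruct (pos p ts) (add W)
    add-neg  : FitsStruct (neg p ts) (add W)
    invert-⅋ : FitsStruct (A ⅋ B) invert
    invert-∃ : ∀ {A} → FitsStruct (ex A) invert

  applyStruct : Form 0 → StructAnn → Bag
  applyStruct φ       keep    = ⟨ φ ⟩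
  applyStruct φ       (add W) = ⟨ φ ⟩ ⊕ W
  applyStruct (A ⅋ B) invert  = ⟨ A ⟩ ⊕ ⟨ B ⟩
  applyStruct (ex A)  invert  = ⨄ CTerm (λ t → ⟨ A [ t ] ⟩)
  -- junk: invert fits no other formula
  applyStruct φ       invert  = ⟨ φ ⟩

  added : StructAnn → Bag
  added (add W) = W
  added _       = ∅

  applyStruct-pos : ∀ {a} → FitsStruct (pos p ts) a →
                    applyStruct (pos p ts) a ≋ ⟨ pos p ts ⟩ ⊕ added a
  applyStruct-pos keep    = ≋-sym (⊕-identityʳ _)
  applyStruct-pos add-pos = ≋-refl

  applyStruct-neg : ∀ {a} → FitsStruct (neg p ts) a →
                    applyStruct (neg p ts) a ≋ ⟨ neg p ts ⟩ ⊕ added a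
  applyStruct-neg keep    = ≋-sym (⊕-identityʳ _)
  applyStruct-neg add-neg = ≋-refl

  module Struct = Replacement FitsStruct applyStruct

  struct-compatible : Struct.Compatible
  struct-compatible = record
    { at-init = λ Γ p ts {a} {b} fa fb →
        Derivable-resp
          (≋-trans (shuffle Γ (added a) (added b) ⟨ pos p ts ⟩ ⟨ neg p ts ⟩)
            (⊕-cong (⊕-cong ≋-refl (≋-sym (applyStruct-pos fa)))
                    (≋-sym (applyStruct-neg fb))))
          (axiom (Γ ⊕ added a ⊕ added b) p ts)
    ; at-⅋ = λ where
        Γ A B keep     IH → ⅋-intro (IH keep keep)
        Γ A B invert-⅋ IH → Derivable-resp (⊕-assoc Γ ⟨ A ⟩ ⟨ B ⟩) (IH keep keep)
    ; at-⊗ = λ where _ _ _ _ keep IH₁ IH₂ → ⊗-intro (IH₁ keep) (IH₂ keep)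
    ; at-∀ = λ where _ _ keep IH → ∀-intro λ t → IH t keep
    ; at-∃ = λ where
        _ _ keep     IH → ∃-intro (IH λ _ → keep)
        _ _ invert-∃ IH → IH λ _ → keep
    }
    where
    shuffle : ∀ Γ E₁ E₂ P N → Γ ⊕ E₁ ⊕ E₂ ⊕ P ⊕ N ≋ Γ ⊕ (P ⊕ E₁) ⊕ (N ⊕ E₂)
    shuffle = solve 5 (λ Γ E₁ E₂ P N → (((Γ ⊞ E₁) ⊞ E₂) ⊞ P) ⊞ N ⊜ (Γ ⊞ (P ⊞ E₁)) ⊞ (N ⊞ E₂)) ≋-refl

  applyStruct-admissible : ∀ {a} → Countable (Bag.I Γ) → FitsStruct φ a →
                           Derivable (Γ ⊕ ⟨ φ ⟩) → Derivable (Γ ⊕ applyStruct φ a)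
  applyStruct-admissible {Γ} {φ} {a} c fa D =
    Derivable-resp (≋-trans (Struct.⟦⟧-snoc Γ φ ρ) (⊕-cong (⨄-singletons Γ) ≋-refl))
      (Struct.replacement struct-compatible (derivation D c′) (sequent-≅ (Γ ⊕ ⟨ φ ⟩) c′)
        ρ (Struct.fits-▸ (λ _ → keep) fa))
    where
    c′ = snoc-countable c
    ρ = (λ _ → keep) Struct.▸ a

  weaken-literal : Countable (Bag.I Γ) → FitsStruct φ (add W) → Derivable (Γ ⊕ ⟨ φ ⟩) →
                   Derivable (Γ ⊕ W ⊕ ⟨ φ ⟩)
  weaken-literal {Γ} {φ} {W} c fa D =
    Derivable-resp (solve 3 (λ Γ L W → Γ ⊞ (L ⊞ W) ⊜ (Γ ⊞ W) ⊞ L) ≋-refl Γ ⟨ φ ⟩ W)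
      (applyStruct-admissible c fa D)

  ⅋-inversion : Countable (Bag.I Γ) → Derivable (Γ ⊕ ⟨ A ⅋ B ⟩) → Derivable (Γ ⊕ (⟨ A ⟩ ⊕ ⟨ B ⟩))
  ⅋-inversion c = applyStruct-admissible c invert-⅋

  ∃-inversion : ∀ {A} → Countable (Bag.I Γ) → Derivable (Γ ⊕ ⟨ ex A ⟩) →
                Derivable (Γ ⊕ ⨄ CTerm (λ t → ⟨ A [ t ] ⟩))
  ∃-inversion c = applyStruct-admissible c invert-∃

  -- Cut

  data CutAnn : Set₁ where
    keep : CutAnn
    cut  : Bag → CutAnn

  applyCut : Form 0 → CutAnn → Bag
  applyCut φ keep    = ⟨ φ ⟩
  applyCut φ (cut Δ) = Δ

  -- Below is _< m inside the induction on the cut weight m, and trivial at the top level.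
  data FitsCut (Below : ℕ → Set) : Form 0 → CutAnn → Set₁ where
    keep : FitsCut Below φ keep
    cut  : Below (weight φ) → Countable (Bag.I Δ) → Derivable (Δ ⊕ ⟨ dual φ ⟩) →
           FitsCut Below φ (cut Δ)

  module Cuts (Below : ℕ → Set) = Replacement (FitsCut Below) applyCut

  multicut : ∀ {Below} → Cuts.Replaceable Below (Γ ⊕ Ψ) → (Θ : Bag.I Ψ → Bag) →
             (∀ ψ → FitsCut Below (Bag.lab Ψ ψ) (cut (Θ ψ))) → Derivable (Γ ⊕ ⨄ (Bag.I Ψ) Θ)
  multicut {Γ} {Ψ} {Below} R Θ fΘ =
    Derivable-resp (≋-trans (Cuts.⟦⟧-⊕ Below Γ Ψ ρ) (⊕-cong (⨄-singletons Γ) ≋-refl))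
      (R ρ λ { (inj₁ _) → keep ; (inj₂ ψ) → fΘ ψ })
    where
    ρ : Bag.I (Γ ⊕ Ψ) → CutAnn
    ρ (inj₁ _) = keep
    ρ (inj₂ ψ) = cut (Θ ψ)

  CutAdmissibleBelow : ℕ → Set₁
  CutAdmissibleBelow m = ∀ {S X} → ⊢ S → S ≅ X → Cuts.Replaceable (_< m) X

  module CutStep (Below : ℕ → Set) (admissible : ∀ {m} → Below m → CutAdmissibleBelow m) where

    multicut-below : ∀ {m} → Below m → Countable (Bag.I (Γ ⊕ Ψ)) → Derivable (Γ ⊕ Ψ) →
                     (Θ : Bag.I Ψ → Bag) → (∀ ψ → FitsCut (_< m) (Bag.lab Ψ ψ) (cut (Θ ψ))) →
                     Derivable (Γ ⊕ ⨄ (Bag.I Ψ) Θ)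
    multicut-below {Γ} {Ψ} b c D = multicut (admissible b (derivation D c) (sequent-≅ (Γ ⊕ Ψ) c))

    cut-below : ∀ {m} → Below m → weight φ < m →
                Countable (Bag.I Γ) → Derivable (Γ ⊕ ⟨ φ ⟩) →
                Countable (Bag.I Δ) → Derivable (Δ ⊕ ⟨ dual φ ⟩) → Derivable (Γ ⊕ Δ)
    cut-below {Δ = Δ} b lt cΓ D cΔ E =
      Derivable-resp (⊕-cong ≋-refl (⨄-⊤ _))
        (multicut-below b (snoc-countable cΓ) D (λ _ → Δ) λ _ → cut lt cΔ E)

    compatible : Cuts.Compatible Below
    compatible = record
      { at-init = at-init
      ; at-⅋ = at-⅋
      ; at-⊗ = at-⊗
      ; at-∀ = at-∀
      ; at-∃ = at-∃
      }
      where
      at-init : ∀ Γ p ts {a b} → FitsCut Below (pos p ts) a → FitsCut Below (neg p ts) b →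
                Derivable (Γ ⊕ applyCut (pos p ts) a ⊕ applyCut (neg p ts) b)
      at-init Γ p ts keep keep = axiom Γ p ts
      at-init Γ p ts (cut _ cΔ D) keep T e =
        Derivable-resp (⊕-cong (⊕-comm _ Γ) ≋-refl) (weaken-literal cΔ add-neg D) T e
      at-init Γ p ts {b = cut Δ} keep (cut _ cΔ D) =
        Derivable-resp (solve 3 (λ Γ Δ P → (Δ ⊞ Γ) ⊞ P ⊜ (Γ ⊞ P) ⊞ Δ) ≋-refl Γ Δ ⟨ pos p ts ⟩)
          (weaken-literal cΔ add-pos D)
      at-init Γ p ts {cut Δ₁} {cut Δ₂} (cut _ c₁ D₁) (cut b c₂ D₂) T e =
        Derivable-resp (solve 3 (λ Γ Δ₁ Δ₂ → Δ₂ ⊞ (Δ₁ ⊞ Γ) ⊜ (Γ ⊞ Δ₁) ⊞ Δ₂) ≋-refl Γ Δ₁ Δ₂)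
          (cut-below b (s≤s z≤n) c₂ D₂ (⊎-countable c₁ cΓ) (weaken-literal c₁ add-neg D₁)) T e
        where cΓ = ⊎-countableˡ (⊎-countableˡ (↔-countable (proj₁ e) (Seq.countable T)))

      at-⅋ : ∀ Γ A B {r} → FitsCut Below (A ⅋ B) r →
             (∀ {a b} → FitsCut Below A a → FitsCut Below B b →
                Derivable (Γ ⊕ applyCut A a ⊕ applyCut B b)) →
             Derivable (Γ ⊕ applyCut (A ⅋ B) r)
      at-⅋ Γ A B keep IH = ⅋-intro (IH keep keep)
      at-⅋ Γ A B (cut b cΔ D) IH T e =
        Derivable-resp (⊕-comm _ Γ)
          (cut-below b (weight-⅋ A B) cΔ D cΓ
            (Derivable-resp-≡ (sym (cong₂ _⅋_ (dual-involutive A) (dual-involutive B)))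
              (⅋-intro (IH keep keep))))
          T e
        where cΓ = ⊎-countableˡ (↔-countable (proj₁ e) (Seq.countable T))

      at-∃ : ∀ Γ A {r} → FitsCut Below (ex A) r →
             (∀ {a : CTerm → CutAnn} → (∀ t → FitsCut Below (A [ t ]) (a t)) →
                Derivable (Γ ⊕ ⨄ CTerm (λ t → applyCut (A [ t ]) (a t)))) →
             Derivable (Γ ⊕ applyCut (ex A) r)
      at-∃ Γ A keep IH = ∃-intro (IH λ _ → keep)
      at-∃ Γ A (cut b cΔ D) IH T e =
        Derivable-resp (⊕-comm _ Γ)
          (cut-below b (weight-∃ A) cΔ D cΓ
            (Derivable-resp-≡ (sym (cong ex (dual-involutive A))) (∃-intro (IH λ _ → keep))))
          T e
        where cΓ = ⊎-countableˡ (↔-countable (proj₁ e) (Seq.countable T))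

      at-⊗ : ∀ Γ₁ Γ₂ A B {r} → FitsCut Below (A ⊗ B) r →
             (∀ {a} → FitsCut Below A a → Derivable (Γ₁ ⊕ applyCut A a)) →
             (∀ {b} → FitsCut Below B b → Derivable (Γ₂ ⊕ applyCut B b)) →
             Derivable (Γ₁ ⊕ Γ₂ ⊕ applyCut (A ⊗ B) r)
      at-⊗ Γ₁ Γ₂ A B keep IH₁ IH₂ = ⊗-intro (IH₁ keep) (IH₂ keep)
      at-⊗ Γ₁ Γ₂ A B {cut Δ} (cut b cΔ D) IH₁ IH₂ T e =
        Derivable-resp rearrange
          (multicut-below b (⊎-countable cΔ (snoc-countable ⊤-countable))
            (⅋-inversion cΔ D) Θ fΘ) T e
        where
        cΓ₁₂ = ⊎-countableˡ (↔-countable (proj₁ e) (Seq.countable T))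
        Θ : ⊤ ⊎ ⊤ → Bag
        Θ (inj₁ _) = Γ₁
        Θ (inj₂ _) = Γ₂
        fΘ : ∀ ψ → FitsCut (_< weight (A ⊗ B)) (Bag.lab (⟨ dual A ⟩ ⊕ ⟨ dual B ⟩) ψ) (cut (Θ ψ))
        fΘ (inj₁ _) = cut (weight-⊗ˡ A B) (⊎-countableˡ cΓ₁₂)
                          (Derivable-resp-≡ (sym (dual-involutive A)) (IH₁ keep))
        fΘ (inj₂ _) = cut (weight-⊗ʳ A B) (⊎-countableʳ cΓ₁₂)
                          (Derivable-resp-≡ (sym (dual-involutive B)) (IH₂ keep))
        rearrange : Δ ⊕ ⨄ (⊤ ⊎ ⊤) Θ ≋ Γ₁ ⊕ Γ₂ ⊕ Δ
        rearrange = ≋-trans (⊕-cong ≋-refl (≋-trans (⨄-⊎ Θ) (⊕-cong (⨄-⊤ _) (⨄-⊤ _))))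
                            (solve 3 (λ Δ Γ₁ Γ₂ → Δ ⊞ (Γ₁ ⊞ Γ₂) ⊜ (Γ₁ ⊞ Γ₂) ⊞ Δ) ≋-refl Δ Γ₁ Γ₂)

      at-∀ : ∀ (Γ : CTerm → Bag) A {r} → FitsCut Below (all A) r →
             (∀ t {a} → FitsCut Below (A [ t ]) a → Derivable (Γ t ⊕ applyCut (A [ t ]) a)) →
             Derivable (⨄ CTerm Γ ⊕ applyCut (all A) r)
      at-∀ Γ A keep IH = ∀-intro λ t → IH t keep
      at-∀ Γ A {cut Δ} (cut b cΔ D) IH T e =
        Derivable-resp rearrange
          (multicut-below b (⊎-countable cΔ (Σ-countable CTerm-countable λ _ → ⊤-countable))
            (∃-inversion cΔ D) (λ (t , _) → Γ t) fΘ) T e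
        where
        cΓ = Σ-countable-fibre (⊎-countableˡ (↔-countable (proj₁ e) (Seq.countable T)))
        fΘ : ∀ ψ → FitsCut (_< weight (all A)) (dual A [ proj₁ ψ ]) (cut (Γ (proj₁ ψ)))
        fΘ (t , _) =
          cut (weight-∀ A t) (cΓ t) (Derivable-resp-≡ (sym (dual-dual-[] A t)) (IH t keep))
        rearrange : Δ ⊕ ⨄ (Σ CTerm λ _ → ⊤) (λ (t , _) → Γ t) ≋ ⨄ CTerm Γ ⊕ Δ
        rearrange = ≋-trans (⊕-cong ≋-refl (≋-trans (⨄-Σ _) (⨄-cong λ t → ⨄-⊤ _))) (⊕-comm Δ _)

  cut-admissible-below : ∀ m → CutAdmissibleBelow m
  cut-admissible-below = <-rec CutAdmissibleBelow λ m admissible →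
    Cuts.replacement (_< m) (CutStep.compatible (_< m) admissible)

  cut-admissible : ⊢ S → S ≅ X → Cuts.Replaceable (λ _ → ⊤) X
  cut-admissible = Cuts.replacement _ (CutStep.compatible (λ _ → ⊤) λ _ → cut-admissible-below _)

  infinitary-cut : ∀ (S : Seq) (Γ Φ : Bag) → S ≅ Γ ⊕ Φ → ⊢ S →
                   (T : Bag.I Φ → Seq) (Δ : Bag.I Φ → Bag) →
                   (∀ φ → T φ ≅ Δ φ ⊕ ⟨ dual (Bag.lab Φ φ) ⟩) → (∀ φ → ⊢ T φ) →
                   (C : Seq) → C ≅ Γ ⊕ ⨄ (Bag.I Φ) Δ → ⊢ C
  infinitary-cut S Γ Φ e d T Δ eT dT =
    multicut (cut-admissible {S} d e) Δ λ φ →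
      cut tt (⊎-countableˡ (↔-countable (proj₁ (eT φ)) (Seq.countable (T φ))))
             (derivable {X = Δ φ ⊕ ⟨ dual (Bag.lab Φ φ) ⟩} (dT φ) (eT φ))

  binary-cut : ∀ (S₁ S₂ : Seq) (Γ Δ : Bag) (A : Form 0) →
               S₁ ≅ Γ ⊕ ⟨ A ⟩ → ⊢ S₁ → S₂ ≅ Δ ⊕ ⟨ dual A ⟩ → ⊢ S₂ →
               (C : Seq) → C ≅ Γ ⊕ Δ → ⊢ C
  binary-cut S₁ S₂ Γ Δ A e₁ d₁ e₂ d₂ C e =
    infinitary-cut S₁ Γ ⟨ A ⟩ e₁ d₁ (λ _ → S₂) (λ _ → Δ) (λ _ → e₂) (λ _ → d₂) C
      (≅-resp-≋ {C} e (⊕-cong ≋-refl (≋-sym (⨄-⊤ _))))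

mainTheorem6 : (σ : Signature) → let open IK σ in
    -- infinitary cut: from ⊢ Γ,Φ and ⊢ Δ_φ, φ̄ (each φ ∈ Φ) infer ⊢ Γ, ⨄_φ Δ_φ
    (∀ (S : Seq) (Γ Φ : Bag) → S ≅ Γ ⊕ Φ → ⊢ S →
       (T : Bag.I Φ → Seq) (Δ : Bag.I Φ → Bag) →
       (∀ φ → T φ ≅ Δ φ ⊕ ⟨ dual (Bag.lab Φ φ) ⟩) → (∀ φ → ⊢ T φ) →
       (C : Seq) → C ≅ Γ ⊕ ⨄ (Bag.I Φ) Δ → ⊢ C)
    ×
    -- ordinary cut: from ⊢ Γ,A and ⊢ Δ,Ā infer ⊢ Γ,Δ
    (∀ (S₁ S₂ : Seq) (Γ Δ : Bag) (A : Form 0) →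
       S₁ ≅ Γ ⊕ ⟨ A ⟩ → ⊢ S₁ → S₂ ≅ Δ ⊕ ⟨ dual A ⟩ → ⊢ S₂ →
       (C : Seq) → C ≅ Γ ⊕ Δ → ⊢ C)
mainTheorem6 σ = infinitary-cut , binary-cut
  where open CutElimination σ
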